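{- Let $\Gamma$ be a finite simple undirected graph of order $n$ with a cut vertex $x$. Suppose that the connected components of $\Gamma - x$ are $\Gamma_1,\ldots,\Gamma_t$, with $|V(\Gamma_i)| = n_i$ for $i\in\{1,\ldots,t\}$, where $n_t\le n_{t-1}\le\cdots\le n_1$. If $n_1\le \sum_{i=2}^{t} n_i$, then $\lambda(\Gamma)\le n$.
   Context: A vertex $x$ of a graph $\Gamma$ is a cut vertex if $\Gamma - x$ (the graph obtained by deleting $x$) has more connected components than $\Gamma$. An $L(2,1)$-labeling of a graph $\Gamma$ is a function $f:V(\Gamma)\to\mathbb{Z}_{\ge 0}$ such that $|f(u)-f(v)|\ge 2$ whenever $u,v$ are adjacent and $|f(u)-f(v)|\ge 1$ whenever $u,v$ are at distance two. The span of $f$ is $\max f - \min f$, and the $\lambda$-number $\lambda(\Gamma)$ is the minimum span over all $L(2,1)$-labelings of $\Gamma$. -}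

module Defs where

open import Data.Bool using (Bool; true; false; _∧_; _∨_; not; if_then_else_)
open import Data.Nat using (ℕ; zero; suc; _+_; _∸_; _≤_; _<_; ∣_-_∣)
open import Data.Fin using (Fin; toℕ)
open import Data.Fin.Properties using (_≟_)
open import Data.List using (List; []; _∷_; allFin)
open import Data.Bool.ListAction using (any; all)
open import Data.Product using (Σ; _×_; ∃)
open import Relation.Nullary using (¬_)
open import Relation.Nullary.Decidable using (⌊_⌋)
open import Relation.Binary.PropositionalEquality using (_≡_; _≢_)

record Graph (n : ℕ) : Set where
  field
    adj   : Fin n → Fin n → Bool
    sym   : ∀ u v → adj u v ≡ adj v u
    irrefl : ∀ v → adj v v ≡ false
open Graph public

_==_ : {n : ℕ} → Fin n → Fin n → Bool
u == v = ⌊ u ≟ v ⌋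

VSet : ℕ → Set
VSet n = Fin n → Bool

allV : {n : ℕ} → VSet n
allV _ = true

minus : {n : ℕ} → Fin n → VSet n
minus x w = not (w == x)

-- reachIn Γ S k u v : there is a walk of length ≤ k from u to v whose
-- vertices after u all lie in S (in the induced subgraph on S).
reachIn : {n : ℕ} → Graph n → VSet n → ℕ → Fin n → Fin n → Bool
reachIn Γ S zero    u v = u == v
reachIn {n} Γ S (suc k) u v =
  (u == v) ∨ any (λ w → S w ∧ adj Γ u w ∧ reachIn Γ S k w v) (allFin n)

-- u and v lie in the same connected component of the induced subgraph Γ[S].
-- (A walk in a graph on n vertices can be shortened to a path of length < n.)
connIn : {n : ℕ} → Graph n → VSet n → Fin n → Fin n → Bool
connIn {n} Γ S u v = S u ∧ S v ∧ reachIn Γ S n u v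

countL : {A : Set} → (A → Bool) → List A → ℕ
countL p []       = 0
countL p (a ∷ as) = (if p a then 1 else 0) + countL p as

countV : {n : ℕ} → (Fin n → Bool) → ℕ
countV {n} p = countL p (allFin n)

-- Number of connected components of Γ[S]: each component is counted once,
-- via its vertex of least index.
numComponents : {n : ℕ} → Graph n → VSet n → ℕ
numComponents {n} Γ S =
  countV (λ v → S v ∧ all (λ u → not (⌊ toℕ u Data.Nat.<? toℕ v ⌋ ∧ connIn Γ S u v)) (allFin n))

CutVertex : {n : ℕ} → Graph n → Fin n → Set
CutVertex Γ x = numComponents Γ allV < numComponents Γ (minus x)

compSize : {n : ℕ} → Graph n → Fin n → Fin n → ℕ
compSize Γ x v = countV (λ w → connIn Γ (minus x) v w)

othersSize : {n : ℕ} → Graph n → Fin n → Fin n → ℕ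
othersSize Γ x v = countV (λ w → minus x w ∧ not (connIn Γ (minus x) v w))

Dist2 : {n : ℕ} → Graph n → Fin n → Fin n → Set
Dist2 Γ u v = u ≢ v × adj Γ u v ≡ false × ∃ (λ w → adj Γ u w ≡ true × adj Γ w v ≡ true)

IsL21Labeling : {n : ℕ} → Graph n → (Fin n → ℕ) → Set
IsL21Labeling Γ f =
  (∀ u v → adj Γ u v ≡ true → 2 ≤ ∣ f u - f v ∣) ×
  (∀ u v → Dist2 Γ u v → 1 ≤ ∣ f u - f v ∣)

SpanAtMost : {n : ℕ} → (Fin n → ℕ) → ℕ → Set
SpanAtMost f k = ∀ u v → f u ∸ f v ≤ k

-- λ(Γ) ≤ k: some L(2,1)-labeling has span at most k (λ is the minimum span).
LambdaAtMost : {n : ℕ} → Graph n → ℕ → Set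
LambdaAtMost Γ k = Σ (_ → ℕ) (λ f → IsL21Labeling Γ f × SpanAtMost f k)

-- Let m be the order of Γ − x and b the largest order of one of its components, so that the
-- hypothesis gives 2b ≤ m.  List the vertices of Γ − x component by component, let r(v) be the
-- position of v, put h = ⌊m/2⌋, and send r to 2r + 1 if r < h and to 2(r − h) otherwise.  Values
-- that differ by one come from positions at least h ≥ b apart, hence from different components,
-- hence from non-adjacent vertices.  So labelling x by 0 and every other v by 2 plus the image of
-- r(v) gives distinct labels in {0} ∪ [2, m + 1] ⊆ [0, n] that differ by at least 2 along edges.

module Submission where

open import Defs renaming (sym to adj-sym)
open import Data.Bool using (Bool; true; false; _∧_; _∨_; not; if_then_else_)
import Data.Bool as Bool
open import Data.Bool.Properties using (∧-conicalˡ; ∧-conicalʳ; ∧-zeroʳ; ∨-zeroʳ)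
open import Data.Bool.ListAction using (any)
open import Data.Nat
  using (ℕ; zero; suc; _+_; _*_; _∸_; _≤_; _<_; _≤?_; _<?_; z≤n; s≤s; s≤s⁻¹; ∣_-_∣)
open import Data.Nat.Properties
open import Data.Nat.DivMod using (_/_; _%_; m/n*n≤m; m≡m%n+[m/n]*n; m%n<n; m*n/n≡m; /-monoˡ-≤)
open import Data.Fin as Fin using (Fin; toℕ; combine)
import Data.Fin.Properties as Fin
open import Data.List using (List; []; _∷_; length; allFin)
open import Data.List.Properties using (length-tabulate)
open import Data.List.Membership.Propositional using (_∈_)
open import Data.List.Membership.Propositional.Properties using (∈-allFin)
open import Data.List.Relation.Unary.Any using (here; there)
import Data.List.Relation.Unary.All as All
open import Data.List.Extrema.Nat using (argmax; f[xs]≤f[argmax])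
open import Data.Product using (∃-syntax; _×_; _,_; proj₁; proj₂)
open import Data.Sum using (_⊎_; inj₁; inj₂)
open import Function using (_∘_; id)
open import Relation.Nullary using (yes; no; contradiction)
open import Relation.Nullary.Decidable using (⌊_⌋)
open import Relation.Binary.PropositionalEquality
open import Relation.Binary.Definitions using (tri<; tri≈; tri>)

==-refl : ∀ {n} (u : Fin n) → (u == u) ≡ true
==-refl u with u Fin.≟ u
... | yes _ = refl
... | no u≢u = contradiction refl u≢u

==⇒≡ : ∀ {n} {u v : Fin n} → (u == v) ≡ true → u ≡ v
==⇒≡ {u = u} {v} e with u Fin.≟ v
... | yes u≡v = u≡v

∧-intro : ∀ {a b} → a ≡ true → b ≡ true → a ∧ b ≡ true
∧-intro refl refl = refl

module _ {A : Set} where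

  _⊆ᵇ_ : (A → Bool) → (A → Bool) → Set
  p ⊆ᵇ q = ∀ a → p a ≡ true → q a ≡ true

  countL-mono : {p q : A → Bool} → p ⊆ᵇ q → ∀ xs → countL p xs ≤ countL q xs
  countL-mono {p} {q} p⊆q [] = z≤n
  countL-mono {p} {q} p⊆q (a ∷ xs) with p a in pa | q a in qa
  ... | true  | true  = s≤s (countL-mono p⊆q xs)
  ... | true  | false = contradiction (trans (sym qa) (p⊆q a pa)) λ ()
  ... | false | true  = m≤n⇒m≤1+n (countL-mono p⊆q xs)
  ... | false | false = countL-mono p⊆q xs

  countL-mono-< : {p q : A → Bool} → p ⊆ᵇ q → ∀ {a} xs → a ∈ xs → q a ≡ true → p a ≡ false →
                  countL p xs < countL q xs
  countL-mono-< p⊆q (b ∷ xs) (here refl) qa pa rewrite qa | pa = s≤s (countL-mono p⊆q xs)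
  countL-mono-< {p} {q} p⊆q (b ∷ xs) (there a∈xs) qa pa with p b in pb | q b in qb
  ... | true  | true  = s≤s (countL-mono-< p⊆q xs a∈xs qa pa)
  ... | true  | false = contradiction (trans (sym qb) (p⊆q b pb)) λ ()
  ... | false | true  = m≤n⇒m≤1+n (countL-mono-< p⊆q xs a∈xs qa pa)
  ... | false | false = countL-mono-< p⊆q xs a∈xs qa pa

  countL-split : (p q : A → Bool) → ∀ xs →
                 countL p xs ≡ countL (λ a → p a ∧ q a) xs + countL (λ a → p a ∧ not (q a)) xs
  countL-split p q [] = refl
  countL-split p q (a ∷ xs) with p a | q a
  ... | true  | true  = cong suc (countL-split p q xs)
  ... | true  | false = trans (cong suc (countL-split p q xs)) (sym (+-suc _ _))
  ... | false | _     = countL-split p q xs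

  countL≤length : (p : A → Bool) → ∀ xs → countL p xs ≤ length xs
  countL≤length p [] = z≤n
  countL≤length p (a ∷ xs) with p a
  ... | true  = s≤s (countL≤length p xs)
  ... | false = m≤n⇒m≤1+n (countL≤length p xs)

  countL-true : (xs : List A) → countL (λ _ → true) xs ≡ length xs
  countL-true []       = refl
  countL-true (a ∷ xs) = cong suc (countL-true xs)

module _ {n : ℕ} where

  countV-mono : {p q : Fin n → Bool} → p ⊆ᵇ q → countV p ≤ countV q
  countV-mono p⊆q = countL-mono p⊆q (allFin n)

  countV-mono-< : {p q : Fin n → Bool} → p ⊆ᵇ q → ∀ {a} → q a ≡ true → p a ≡ false →
                  countV p < countV q
  countV-mono-< p⊆q {a} = countL-mono-< p⊆q (allFin n) (∈-allFin a)

  countV-split : (p q : Fin n → Bool) →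
                 countV p ≡ countV (λ a → p a ∧ q a) + countV (λ a → p a ∧ not (q a))
  countV-split p q = countL-split p q (allFin n)

  countV≤n : (p : Fin n → Bool) → countV p ≤ n
  countV≤n p = subst (countV p ≤_) (length-tabulate (id {A = Fin n})) (countL≤length p (allFin n))

  countV-allV : countV {n} allV ≡ n
  countV-allV = trans (countL-true (allFin n)) (length-tabulate (id {A = Fin n}))

  countV-≤⇒⊇ : {p q : Fin n → Bool} → p ⊆ᵇ q → countV q ≤ countV p → q ⊆ᵇ p
  countV-≤⇒⊇ {p} p⊆q q≤p a qa with p a in pa
  ... | true  = refl
  ... | false = contradiction q≤p (<⇒≱ (countV-mono-< p⊆q qa pa))

bounded-sequence-stalls : (c : ℕ → ℕ) (B : ℕ) → (∀ k → c k ≤ B) →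
                          ∃[ k ] k ≤ B × c (suc k) ≤ c k
bounded-sequence-stalls c B c≤B with stalls-or-grows (suc B)
  where
  stalls-or-grows : ∀ j → (∃[ k ] k < j × c (suc k) ≤ c k) ⊎ j ≤ c j
  stalls-or-grows zero = inj₂ z≤n
  stalls-or-grows (suc j) with stalls-or-grows j
  ... | inj₁ (k , k<j , stall) = inj₁ (k , m≤n⇒m≤1+n k<j , stall)
  ... | inj₂ j≤cj with c (suc j) ≤? c j
  ...   | yes stall = inj₁ (j , ≤-refl , stall)
  ...   | no grow   = inj₂ (≤-<-trans j≤cj (≰⇒> grow))
... | inj₁ (k , s≤s k≤B , stall) = k , k≤B , stall
... | inj₂ B<c = contradiction (c≤B (suc B)) (<⇒≱ B<c)

module Reachability {n : ℕ} (Γ : Graph n) (S : VSet n) where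

  Reach : ℕ → Fin n → Fin n → Set
  Reach k u v = reachIn Γ S k u v ≡ true

  reach-refl : ∀ k u → Reach k u u
  reach-refl zero    u = ==-refl u
  reach-refl (suc k) u rewrite ==-refl u = refl

  reach-step : ∀ k {u w v} → S w ≡ true → adj Γ u w ≡ true → Reach k w v → Reach (suc k) u v
  reach-step k {u} {w} {v} sw uw wv =
    trans (cong ((u == v) ∨_) (any-intro (allFin n) (∈-allFin w))) (∨-zeroʳ _)
    where
    any-intro : ∀ ws → w ∈ ws → any (λ z → S z ∧ adj Γ u z ∧ reachIn Γ S k z v) ws ≡ true
    any-intro (z ∷ ws) (here refl) rewrite sw | uw | wv = refl
    any-intro (z ∷ ws) (there w∈ws) = trans (cong (_ ∨_) (any-intro ws w∈ws)) (∨-zeroʳ _)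

  reach-unstep : ∀ k {u v} → Reach (suc k) u v →
                 u ≡ v ⊎ ∃[ w ] S w ≡ true × adj Γ u w ≡ true × Reach k w v
  reach-unstep k {u} {v} r with u == v in u=v
  ... | true  = inj₁ (==⇒≡ u=v)
  ... | false = inj₂ (any-elim (allFin n) r)
    where
    any-elim : ∀ ws → any (λ w → S w ∧ adj Γ u w ∧ reachIn Γ S k w v) ws ≡ true →
               ∃[ w ] S w ≡ true × adj Γ u w ≡ true × Reach k w v
    any-elim (w ∷ ws) e with S w in sw | adj Γ u w in uw | reachIn Γ S k w v in wv
    ... | true  | true  | true  = w , sw , uw , wv
    ... | false | _     | _     = any-elim ws e
    ... | true  | false | _     = any-elim ws e
    ... | true  | true  | false = any-elim ws e

  reach-suc : ∀ k {u v} → Reach k u v → Reach (suc k) u v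
  reach-suc zero    r rewrite r = refl
  reach-suc (suc k) {u} r with reach-unstep k r
  ... | inj₁ refl = reach-refl (suc (suc k)) u
  ... | inj₂ (w , sw , uw , wv) = reach-step (suc k) sw uw (reach-suc k wv)

  reach-++ : ∀ a b {u v w} → Reach a u v → Reach b v w → Reach (a + b) u w
  reach-++ zero    b uv vw rewrite ==⇒≡ uv = vw
  reach-++ (suc a) b {v = v} uv vw with reach-unstep a uv
  ... | inj₁ refl = reach-suc (a + b) (reach-++ a b (reach-refl a v) vw)
  ... | inj₂ (z , sz , uz , zv) = reach-step (a + b) sz uz (reach-++ a b zv vw)

  reach-mono : ∀ {j k u v} → j ≤ k → Reach j u v → Reach k u v
  reach-mono {j} {k} {u} {v} j≤k uv =
    subst (λ l → Reach l u v) (m+[n∸m]≡n j≤k) (reach-++ j (k ∸ j) uv (reach-refl (k ∸ j) v))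

  reach-snoc : ∀ k {u w v} → Reach k u w → S v ≡ true → adj Γ w v ≡ true → Reach (suc k) u v
  reach-snoc k {u} {w} {v} uw sv wv =
    subst (λ l → Reach l u v) (+-comm k 1) (reach-++ k 1 uw (reach-step 0 sv wv (reach-refl 0 v)))

  reach-sym : ∀ k {u v} → S u ≡ true → Reach k u v → Reach k v u
  reach-sym zero    su uv rewrite ==⇒≡ uv = reach-refl 0 _
  reach-sym (suc k) {u} su uv with reach-unstep k uv
  ... | inj₁ refl = reach-refl (suc k) u
  ... | inj₂ (w , sw , uw , wv) = reach-snoc k (reach-sym k sw wv) su (trans (adj-sym Γ w u) uw)

  reach-preserves-S : ∀ k {u v} → S u ≡ true → Reach k u v → S v ≡ true
  reach-preserves-S zero    su uv = subst (λ z → S z ≡ true) (==⇒≡ uv) su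
  reach-preserves-S (suc k) su uv with reach-unstep k uv
  ... | inj₁ refl = su
  ... | inj₂ (w , sw , _ , wv) = reach-preserves-S k sw wv

  -- Fix the target v.  Once one more step adds no new sources, no later step does, and the
  -- number of sources is at most n, so this happens within the first n steps.
  module _ (v : Fin n) where

    Stalls : ℕ → Set
    Stalls k = ∀ u → Reach (suc k) u v → Reach k u v

    stalls-suc : ∀ k → Stalls k → Stalls (suc k)
    stalls-suc k stall u uv with reach-unstep (suc k) uv
    ... | inj₁ refl = reach-refl (suc k) u
    ... | inj₂ (w , sw , uw , wv) = reach-step k sw uw (stall w wv)

    stalls-+ : ∀ j k → Stalls k → Stalls (j + k)
    stalls-+ zero    k stall = stall
    stalls-+ (suc j) k stall = stalls-suc (j + k) (stalls-+ j k stall)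

    stalls-collapse : ∀ j k → Stalls k → ∀ u → Reach (j + k) u v → Reach k u v
    stalls-collapse zero    k stall u uv = uv
    stalls-collapse (suc j) k stall u uv = stalls-collapse j k stall u (stalls-+ j k stall u uv)

    stalls-within-n : ∃[ k ] k ≤ n × Stalls k
    stalls-within-n
      with bounded-sequence-stalls (λ k → countV (λ u → reachIn Γ S k u v)) n (λ k → countV≤n _)
    ... | k , k≤n , stall = k , k≤n , countV-≤⇒⊇ (λ u → reach-suc k) stall

    reach-shorten : ∀ j u → Reach (j + n) u v → Reach n u v
    reach-shorten j u uv with stalls-within-n
    ... | k , k≤n , stall =
      reach-mono k≤n (stalls-collapse (j + (n ∸ k)) k stall u (subst (λ l → Reach l u v) j+n≡ uv))
      where
      j+n≡ : j + n ≡ j + (n ∸ k) + k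
      j+n≡ = trans (cong (j +_) (sym (m∸n+n≡m k≤n))) (sym (+-assoc j (n ∸ k) k))

  reach-trans : ∀ {u v w} → Reach n u v → Reach n v w → Reach n u w
  reach-trans {u} {w = w} uv vw = reach-shorten w n u (reach-++ n n uv vw)

least : ∀ {m} (p : Fin m → Bool) {i} → p i ≡ true →
        ∃[ j ] p j ≡ true × (∀ k → p k ≡ true → j Fin.≤ k)
least {suc m} p {Fin.zero}  pi = Fin.zero , pi , λ _ _ → z≤n
least {suc m} p {Fin.suc i} pi with p Fin.zero in p0
... | true  = Fin.zero , p0 , λ _ _ → z≤n
... | false with least (p ∘ Fin.suc) pi
...   | j , pj , j-least = Fin.suc j , pj , λ
  { Fin.zero    pk → contradiction (trans (sym p0) pk) λ ()
  ; (Fin.suc k) pk → s≤s (j-least k pk) }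

module Components {n : ℕ} (Γ : Graph n) (S : VSet n) where

  open Reachability Γ S

  _∼_ : Fin n → Fin n → Set
  u ∼ v = connIn Γ S u v ≡ true

  ∼-intro : ∀ {u v} → S u ≡ true → Reach n u v → u ∼ v
  ∼-intro su uv = ∧-intro su (∧-intro (reach-preserves-S n su uv) uv)

  ∼-S : ∀ {u v} → u ∼ v → S u ≡ true
  ∼-S uv = ∧-conicalˡ _ _ uv

  ∼-reach : ∀ {u v} → u ∼ v → Reach n u v
  ∼-reach {u} {v} uv = ∧-conicalʳ (S v) _ (∧-conicalʳ (S u) _ uv)

  ∼-refl : ∀ {u} → S u ≡ true → u ∼ u
  ∼-refl {u} su = ∼-intro su (reach-refl n u)

  ∼-sym : ∀ {u v} → u ∼ v → v ∼ u
  ∼-sym uv = ∼-intro (reach-preserves-S n (∼-S uv) (∼-reach uv)) (reach-sym n (∼-S uv) (∼-reach uv))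

  ∼-trans : ∀ {u v w} → u ∼ v → v ∼ w → u ∼ w
  ∼-trans uv vw = ∼-intro (∼-S uv) (reach-trans (∼-reach uv) (∼-reach vw))

  adj⇒∼ : ∀ {u v} → S u ≡ true → S v ≡ true → adj Γ u v ≡ true → u ∼ v
  adj⇒∼ {u} {v} su sv uv =
    ∼-intro su (reach-mono (≤-trans (s≤s z≤n) (Fin.toℕ<n u)) (reach-step 0 sv uv (reach-refl 0 v)))

  -- The least vertex reachable from u; reachIn (not connIn) so that u itself is a witness even off S.
  rep : Fin n → Fin n
  rep u = proj₁ (least (reachIn Γ S n u) (reach-refl n u))

  rep-reach : ∀ u → Reach n u (rep u)
  rep-reach u = proj₁ (proj₂ (least (reachIn Γ S n u) (reach-refl n u)))

  rep-least : ∀ {u w} → Reach n u w → rep u Fin.≤ w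
  rep-least {u} {w} = proj₂ (proj₂ (least (reachIn Γ S n u) (reach-refl n u))) w

  ∼⇒rep≡ : ∀ {u w} → u ∼ w → rep u ≡ rep w
  ∼⇒rep≡ {u} {w} uw = Fin.≤-antisym
    (rep-least (reach-trans (∼-reach uw) (rep-reach w)))
    (rep-least (reach-trans (∼-reach (∼-sym uw)) (rep-reach u)))

  rep≡⇒∼ : ∀ {u w} → S u ≡ true → S w ≡ true → rep u ≡ rep w → u ∼ w
  rep≡⇒∼ {u} {w} su sw eq =
    ∼-trans (∼-intro su (rep-reach u)) (∼-sym (subst (w ∼_) (sym eq) (∼-intro sw (rep-reach w))))

  component-split : ∀ u → countV S ≡ countV (connIn Γ S u) + countV (λ w → S w ∧ not (connIn Γ S u w))
  component-split u = trans (countV-split S (connIn Γ S u))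
    (cong (_+ countV (λ w → S w ∧ not (connIn Γ S u w))) (≤-antisym
      (countV-mono λ w → ∧-conicalʳ (S w) _)
      (countV-mono λ w uw → ∧-intro (∼-S (∼-sym {u} {w} uw)) uw)))

  -- Ordering vertices by blockCode lists the components one after another.
  blockCode : Fin n → ℕ
  blockCode u = toℕ (combine (rep u) u)

  blockCode-injective : ∀ {u v} → blockCode u ≡ blockCode v → u ≡ v
  blockCode-injective {u} {v} eq = proj₂ (Fin.combine-injective (rep u) u (rep v) v (Fin.toℕ-injective eq))

  blockCode-mono-rep : ∀ {u v} → blockCode u ≤ blockCode v → rep u Fin.≤ rep v
  blockCode-mono-rep {u} {v} le with toℕ (rep u) ≤? toℕ (rep v)
  ... | yes ru≤rv = ru≤rv
  ... | no  ru≰rv = contradiction le (<⇒≱ (Fin.combine-monoˡ-< v u (≰⇒> ru≰rv)))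

  ∼-convex : ∀ {u a w c} → u ∼ a → u ∼ c → S w ≡ true →
             blockCode a ≤ blockCode w → blockCode w ≤ blockCode c → u ∼ w
  ∼-convex {u} {a} {w} {c} ua uc sw aw wc = rep≡⇒∼ (∼-S ua) sw (Fin.≤-antisym
    (subst (Fin._≤ rep w) (sym (∼⇒rep≡ ua)) (blockCode-mono-rep aw))
    (subst (rep w Fin.≤_) (sym (∼⇒rep≡ uc)) (blockCode-mono-rep wc)))

module Ranking {n : ℕ} (S : VSet n) (code : Fin n → ℕ)
  (code-injective : ∀ {u v} → code u ≡ code v → u ≡ v) where

  below : Fin n → Fin n → Bool
  below v w = S w ∧ ⌊ code w <? code v ⌋

  rank : Fin n → ℕ
  rank v = countV (below v)

  below-intro : ∀ {v w} → S w ≡ true → code w < code v → below v w ≡ true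
  below-intro {v} {w} sw lt with code w <? code v
  ... | yes _ rewrite sw = refl
  ... | no ≮ = contradiction lt ≮

  below⇒< : ∀ {v w} → below v w ≡ true → code w < code v
  below⇒< {v} {w} e with code w <? code v
  ... | yes lt = lt
  ... | no _   = contradiction (trans (sym e) (∧-zeroʳ (S w))) λ ()

  not-below⇒≥ : ∀ {v w} → S w ≡ true → not (below v w) ≡ true → code v ≤ code w
  not-below⇒≥ {v} {w} sw e with code w <? code v
  ... | yes _ rewrite sw = contradiction e λ ()
  ... | no ≮ = ≮⇒≥ ≮

  below-irrefl : ∀ v → below v v ≡ false
  below-irrefl v with code v <? code v
  ... | yes lt = contradiction lt (<-irrefl refl)
  ... | no _   = ∧-zeroʳ (S v)

  rank-mono-< : ∀ {u v} → S u ≡ true → code u < code v → rank u < rank v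
  rank-mono-< {u} {v} su lt = countV-mono-< below-u⊆below-v (below-intro su lt) (below-irrefl u)
    where
    below-u⊆below-v : below u ⊆ᵇ below v
    below-u⊆below-v w e = below-intro (∧-conicalˡ (S w) _ e) (<-trans (below⇒< {u} e) lt)

  rank<count : ∀ {v} → S v ≡ true → rank v < countV S
  rank<count {v} sv = countV-mono-< (λ w → ∧-conicalˡ (S w) _) sv (below-irrefl v)

  rank-injective : ∀ {u v} → S u ≡ true → S v ≡ true → rank u ≡ rank v → u ≡ v
  rank-injective {u} {v} su sv eq with <-cmp (code u) (code v)
  ... | tri< lt _ _ = contradiction eq (<⇒≢ (rank-mono-< su lt))
  ... | tri≈ _ eq′ _ = code-injective eq′
  ... | tri> _ _ gt = contradiction (sym eq) (<⇒≢ (rank-mono-< sv gt))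

  Convex : VSet n → Set
  Convex B = ∀ {a w c} → B a ≡ true → B c ≡ true → S w ≡ true →
             code a ≤ code w → code w ≤ code c → B w ≡ true

  -- Whatever lies below c but not below a lies between a and c, so in B, and is not c.
  rank-close : ∀ {B a c} → Convex B → B a ≡ true → B c ≡ true → rank c < rank a + countV B
  rank-close {B} {a} {c} convex ba bc = begin-strict
    rank c                          ≡⟨ countV-split (below c) (below a) ⟩
    countV shared + countV between  <⟨ +-mono-≤-< (countV-mono shared⊆) (countV-mono-< between⊆ bc c∉) ⟩
    rank a + countV B               ∎
    where
    open ≤-Reasoning
    shared between : Fin n → Bool
    shared  w = below c w ∧ below a w
    between w = below c w ∧ not (below a w)

    shared⊆ : shared ⊆ᵇ below a
    shared⊆ w = ∧-conicalʳ (below c w) (below a w)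

    between⊆ : between ⊆ᵇ B
    between⊆ w e =
      convex ba bc sw (not-below⇒≥ sw (∧-conicalʳ _ _ e)) (<⇒≤ (below⇒< (∧-conicalˡ _ _ e)))
      where
      sw : S w ≡ true
      sw = ∧-conicalˡ _ _ (∧-conicalˡ _ _ e)

    c∉ : between c ≡ false
    c∉ = cong (_∧ not (below a c)) (below-irrefl c)

interleave : ℕ → ℕ → ℕ
interleave h r with r <? h
... | yes _ = suc (2 * r)
... | no  _ = 2 * (r ∸ h)

interleave-view : ∀ h r → r < h × interleave h r ≡ suc (2 * r) ⊎ h ≤ r × interleave h r ≡ 2 * (r ∸ h)
interleave-view h r with r <? h
... | yes r<h = inj₁ (r<h , refl)
... | no  r≮h = inj₂ (≮⇒≥ r≮h , refl)

interleave-injective : ∀ h {a b} → interleave h a ≡ interleave h b → a ≡ b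
interleave-injective h {a} {b} eq with interleave-view h a | interleave-view h b
... | inj₁ (_ , ia) | inj₁ (_ , ib) = *-cancelˡ-≡ a b 2 (suc-injective (trans (sym ia) (trans eq ib)))
... | inj₁ (_ , ia) | inj₂ (_ , ib) = contradiction (sym (trans (sym ia) (trans eq ib))) (even≢odd (b ∸ h) a)
... | inj₂ (_ , ia) | inj₁ (_ , ib) = contradiction (trans (sym ia) (trans eq ib)) (even≢odd (a ∸ h) b)
... | inj₂ (h≤a , ia) | inj₂ (h≤b , ib) =
  ∸-cancelʳ-≡ h≤a h≤b (*-cancelˡ-≡ (a ∸ h) (b ∸ h) 2 (trans (sym ia) (trans eq ib)))

interleave-< : ∀ h {m r} → 2 * h ≤ m → m ≤ suc (2 * h) → r < m → interleave h r < m
interleave-< h {m} {r} 2h≤m m≤2h+1 r<m with interleave-view h r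
... | inj₁ (r<h , ir) rewrite ir =
  ≤-trans (≤-reflexive (sym (*-suc 2 r))) (≤-trans (*-monoʳ-≤ 2 r<h) 2h≤m)
... | inj₂ (h≤r , ir) rewrite ir = begin-strict
  2 * d        ≡⟨ cong (d +_) (+-identityʳ d) ⟩
  d + d        ≤⟨ +-monoʳ-≤ d d≤h ⟩
  d + h        ≡⟨ m∸n+n≡m h≤r ⟩
  r            <⟨ r<m ⟩
  m            ∎
  where
  open ≤-Reasoning
  d : ℕ
  d = r ∸ h
  d≤h : d ≤ h
  d≤h = +-cancelʳ-≤ h d h (begin
    d + h        ≡⟨ m∸n+n≡m h≤r ⟩
    r            ≤⟨ s≤s⁻¹ (≤-trans r<m m≤2h+1) ⟩
    2 * h        ≡⟨ cong (h +_) (+-identityʳ h) ⟩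
    h + h        ∎)

interleave-apart : ∀ h {a b} → suc (interleave h a) ≡ interleave h b → a + h ≤ b ⊎ b + h ≤ a
interleave-apart h {a} {b} eq with interleave-view h a | interleave-view h b
... | inj₁ (_ , ia) | inj₁ (_ , ib) =
  contradiction (sym (suc-injective (trans (cong suc (sym ia)) (trans eq ib)))) (even≢odd b a)
... | inj₁ (_ , ia) | inj₂ (h≤b , ib) = inj₁ (begin
  a + h        ≤⟨ n≤1+n (a + h) ⟩
  suc a + h    ≡⟨ cong (_+ h) halves ⟩
  b ∸ h + h    ≡⟨ m∸n+n≡m h≤b ⟩
  b            ∎)
  where
  open ≤-Reasoning
  halves : suc a ≡ b ∸ h
  halves = *-cancelˡ-≡ (suc a) (b ∸ h) 2 (trans (*-suc 2 a) (trans (cong suc (sym ia)) (trans eq ib)))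
... | inj₂ (h≤a , ia) | inj₁ (_ , ib) = inj₂ (begin
  b + h        ≡⟨ cong (_+ h) halves ⟩
  a ∸ h + h    ≡⟨ m∸n+n≡m h≤a ⟩
  a            ∎)
  where
  open ≤-Reasoning
  halves : b ≡ a ∸ h
  halves = *-cancelˡ-≡ b (a ∸ h) 2 (suc-injective (trans (sym ib) (trans (sym eq) (cong suc ia))))
... | inj₂ (_ , ia) | inj₂ (_ , ib) =
  contradiction (sym (trans (cong suc (sym ia)) (trans eq ib))) (even≢odd (b ∸ h) (a ∸ h))

2≤∣m-n∣ : ∀ {m n} → m ≢ n → suc m ≢ n → suc n ≢ m → 2 ≤ ∣ m - n ∣
2≤∣m-n∣ {zero}        {zero}        m≢n _ _ = contradiction refl m≢n
2≤∣m-n∣ {zero}        {suc zero}    _ m+1≢n _ = contradiction refl m+1≢n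
2≤∣m-n∣ {zero}        {suc (suc n)} _ _ _ = s≤s (s≤s z≤n)
2≤∣m-n∣ {suc zero}    {zero}        _ _ n+1≢m = contradiction refl n+1≢m
2≤∣m-n∣ {suc (suc m)} {zero}        _ _ _ = s≤s (s≤s z≤n)
2≤∣m-n∣ {suc m}       {suc n}       m≢n m+1≢n n+1≢m =
  2≤∣m-n∣ (m≢n ∘ cong suc) (m+1≢n ∘ cong suc) (n+1≢m ∘ cong suc)

1≤∣m-n∣ : ∀ {m n} → m ≢ n → 1 ≤ ∣ m - n ∣
1≤∣m-n∣ m≢n = n≢0⇒n>0 (m≢n ∘ ∣m-n∣≡0⇒m≡n)

module ApexLabelling {n : ℕ} (Γ : Graph n) (x : Fin n) (g : Fin n → ℕ)
  (g-injective : ∀ {u v} → minus x u ≡ true → minus x v ≡ true → g u ≡ g v → u ≡ v)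
  (g-nonconsecutive : ∀ {u v} → minus x u ≡ true → minus x v ≡ true → adj Γ u v ≡ true →
                      suc (g u) ≢ g v)
  where

  label : Fin n → ℕ
  label v = if v == x then 0 else 2 + g v

  label-view : ∀ v → v ≡ x × label v ≡ 0 ⊎ minus x v ≡ true × label v ≡ 2 + g v
  label-view v with v == x in v=x
  ... | true  = inj₁ (==⇒≡ v=x , refl)
  ... | false = inj₂ (refl , refl)

  label-injective : ∀ {u v} → u ≢ v → label u ≢ label v
  label-injective {u} {v} u≢v with label-view u | label-view v
  ... | inj₁ (refl , _)   | inj₁ (refl , _)  = contradiction refl u≢v
  ... | inj₁ (_ , lu)     | inj₂ (_ , lv)    = λ eq → contradiction (trans (sym lu) (trans eq lv)) λ ()
  ... | inj₂ (_ , lu)     | inj₁ (_ , lv)    = λ eq → contradiction (trans (sym lv) (trans (sym eq) lu)) λ ()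
  ... | inj₂ (su , lu)    | inj₂ (sv , lv)   =
    λ eq → u≢v (g-injective su sv (suc-injective (suc-injective (trans (sym lu) (trans eq lv)))))

  adjacent-≢ : ∀ {u v} → adj Γ u v ≡ true → u ≢ v
  adjacent-≢ {u} uv refl = contradiction (trans (sym uv) (irrefl Γ u)) λ ()

  label-adjacent : ∀ {u v} → adj Γ u v ≡ true → 2 ≤ ∣ label u - label v ∣
  label-adjacent {u} {v} uv with label-view u | label-view v
  ... | inj₁ (refl , _)   | inj₁ (refl , _)  = contradiction refl (adjacent-≢ uv)
  ... | inj₁ (_ , lu)     | inj₂ (_ , lv)    rewrite lu | lv = s≤s (s≤s z≤n)
  ... | inj₂ (_ , lu)     | inj₁ (_ , lv)    rewrite lu | lv = s≤s (s≤s z≤n)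
  ... | inj₂ (su , lu)    | inj₂ (sv , lv)   rewrite lu | lv = 2≤∣m-n∣
    (adjacent-≢ uv ∘ g-injective su sv)
    (g-nonconsecutive su sv uv)
    (g-nonconsecutive sv su (trans (adj-sym Γ v u) uv))

  lambda≤ : ∀ {k} → (∀ {v} → minus x v ≡ true → 2 + g v ≤ k) → LambdaAtMost Γ k
  lambda≤ {k} bounded =
    label , ((λ u v → label-adjacent) , (λ u v d → 1≤∣m-n∣ (label-injective (proj₁ d))))
          , (λ u v → ≤-trans (m∸n≤m (label u) (label v)) (label≤k u))
    where
    label≤k : ∀ v → label v ≤ k
    label≤k v with label-view v
    ... | inj₁ (_ , lv)  rewrite lv = z≤n
    ... | inj₂ (sv , lv) rewrite lv = bounded sv

⌊m/2⌋-bounds : ∀ m → 2 * (m / 2) ≤ m × m ≤ suc (2 * (m / 2))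
⌊m/2⌋-bounds m =
    subst (_≤ m) (*-comm (m / 2) 2) (m/n*n≤m m 2)
  , (begin
      m                    ≡⟨ m≡m%n+[m/n]*n m 2 ⟩
      m % 2 + m / 2 * 2    ≤⟨ +-monoˡ-≤ (m / 2 * 2) (s≤s⁻¹ (m%n<n m 2)) ⟩
      suc (m / 2 * 2)      ≡⟨ cong suc (*-comm (m / 2) 2) ⟩
      suc (2 * (m / 2))    ∎)
  where open ≤-Reasoning

smallComponents⇒lambda≤n : ∀ {n} (Γ : Graph n) (x : Fin n) →
  (∀ {v} → minus x v ≡ true → 2 * compSize Γ x v ≤ countV (minus x)) → LambdaAtMost Γ n
smallComponents⇒lambda≤n {n} Γ x small = lambda≤ bounded
  where
  open Components Γ (minus x)
  open Ranking (minus x) blockCode blockCode-injective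

  m h : ℕ
  m = countV (minus x)
  h = m / 2

  component≤h : ∀ {v} → minus x v ≡ true → compSize Γ x v ≤ h
  component≤h {v} sv = subst (_≤ h) (m*n/n≡m (compSize Γ x v) 2)
    (/-monoˡ-≤ 2 (subst (_≤ m) (*-comm 2 (compSize Γ x v)) (small sv)))

  rank-within-h : ∀ {u v} → u ∼ v → rank v < rank u + h
  rank-within-h {u} {v} uv = <-≤-trans
    (rank-close {connIn Γ (minus x) u} (∼-convex {u}) (∼-refl {u} (∼-S {u} {v} uv)) uv)
    (+-monoʳ-≤ (rank u) (component≤h (∼-S {u} {v} uv)))

  g-nonconsecutive : ∀ {u v} → minus x u ≡ true → minus x v ≡ true → adj Γ u v ≡ true →
                     suc (interleave h (rank u)) ≢ interleave h (rank v)
  g-nonconsecutive {u} {v} su sv uv eq with interleave-apart h eq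
  ... | inj₁ u+h≤v = ≤⇒≯ u+h≤v (rank-within-h (adj⇒∼ {u} {v} su sv uv))
  ... | inj₂ v+h≤u = ≤⇒≯ v+h≤u (rank-within-h (adj⇒∼ {v} {u} sv su (trans (adj-sym Γ v u) uv)))

  open ApexLabelling Γ x (interleave h ∘ rank)
    (λ su sv → rank-injective su sv ∘ interleave-injective h) g-nonconsecutive

  m<n : m < n
  m<n = subst (m <_) countV-allV
    (countV-mono-< {q = allV} (λ _ _ → refl) {x} refl (cong not (==-refl x)))

  bounded : ∀ {v} → minus x v ≡ true → 2 + interleave h (rank v) ≤ n
  bounded sv = ≤-trans (s≤s (interleave-< h 2h≤m m≤2h+1 (rank<count sv))) m<n
    where
    2h≤m : 2 * h ≤ m
    2h≤m = proj₁ (⌊m/2⌋-bounds m)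
    m≤2h+1 : m ≤ suc (2 * h)
    m≤2h+1 = proj₂ (⌊m/2⌋-bounds m)

proposition2p2 : (n : ℕ) (Γ : Graph n) (x : Fin n) → CutVertex Γ x →
    (∀ v → minus x v ≡ true → (∀ w → minus x w ≡ true → compSize Γ x w ≤ compSize Γ x v) →
      compSize Γ x v ≤ othersSize Γ x v) →
    LambdaAtMost Γ n
proposition2p2 n Γ x _ balanced = smallComponents⇒lambda≤n Γ x small
  where
  open Components Γ (minus x)

  largest : Fin n
  largest = argmax (compSize Γ x) x (allFin n)

  largest-is-largest : ∀ w → compSize Γ x w ≤ compSize Γ x largest
  largest-is-largest w = All.lookup (f[xs]≤f[argmax] {f = compSize Γ x} x (allFin n)) (∈-allFin w)

  largest≤others : compSize Γ x largest ≤ othersSize Γ x largest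
  largest≤others with minus x largest Bool.≟ true
  ... | yes s = balanced largest s (λ w _ → largest-is-largest w)
  ... | no ¬s = countV-mono {p = connIn Γ (minus x) largest} λ w l∼w → contradiction (∼-S l∼w) ¬s

  small : ∀ {v} → minus x v ≡ true → 2 * compSize Γ x v ≤ countV (minus x)
  small {v} _ = begin
    2 * compSize Γ x v                                ≤⟨ *-monoʳ-≤ 2 (largest-is-largest v) ⟩
    2 * c                                             ≡⟨ cong (c +_) (+-identityʳ c) ⟩
    c + c                                             ≤⟨ +-monoʳ-≤ c largest≤others ⟩
    c + othersSize Γ x largest                        ≡⟨ component-split largest ⟨
    countV (minus x)                                  ∎
    where
    open ≤-Reasoning
    c : ℕ
    c = compSize Γ x largest
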